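{- Let $k,p,r\in\mathbb{N}$. There is some $d\in\mathbb{N}$ depending only on $k$ and $p$ such that if $\rho:\mathbb{Z}\to T_p^r$ is any polynomial mapping of degree at most $k$, then for all $h_1,\dots,h_{d+1}\in\mathbb{Z}$ the derivative $\partial_{h_{d+1}}\cdots\partial_{h_1}\rho$ is identically equal to the identity element.
   Context: $T_p$ denotes the group of $(p+1)\times(p+1)$ real upper-triangular matrices with all diagonal entries equal to $1$, and $T_p^r$ its $r$-fold direct product. A map $\rho=(\rho_1,\dots,\rho_r):\mathbb{Z}\to T_p^r$ is a polynomial mapping of degree at most $k$ if there are real polynomials $\phi_{i,j,l}$ of degree at most $k$ such that for every $n$ the $(i,j)$ entry of $\rho_l(n)$ equals $\phi_{i,j,l}(n)$. For a sequence $g:\mathbb{Z}\to G$ in a group and $h\in\mathbb{Z}$, $\partial_hg(n):=g(n+h)g(n)^{ -1}$. -}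

module Defs where

open import Level using (Level)
open import Algebra.Bundles using (CommutativeRing)
open import Data.Nat using (ℕ; zero; suc)
open import Data.Fin using (Fin; zero; suc; _≟_; _<_)
open import Data.Integer using (ℤ; +_; -[1+_]) renaming (_+_ to _+ℤ_)
open import Relation.Nullary using (yes; no)
open import Function using (_∘_)

module _ {c ℓ : Level} (R : CommutativeRing c ℓ) where
  open CommutativeRing R using (Carrier; _≈_; _+_; _*_; -_; _-_; 0#; 1#)

  sumR : ∀ n → (Fin n → Carrier) → Carrier
  sumR zero    f = 0#
  sumR (suc n) f = f zero + sumR n (f ∘ suc)

  pow : Carrier → ℕ → Carrier
  pow x zero    = 1#
  pow x (suc n) = x * pow x n

  natR : ℕ → Carrier
  natR zero    = 0#
  natR (suc n) = 1# + natR n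

  intR : ℤ → Carrier
  intR (+ n)      = natR n
  intR -[1+ n ]   = - (natR (suc n))

  Poly : ℕ → Set c
  Poly k = Fin (suc k) → Carrier

  evalPoly : ∀ {k} → Poly k → ℤ → Carrier
  evalPoly {k} a n = sumR (suc k) (λ j → a j * pow (intR n) (Data.Fin.toℕ j))

  Mat : ℕ → Set c
  Mat m = Fin m → Fin m → Carrier

  I : ∀ {m} → Mat m
  I i j with i ≟ j
  ... | yes _ = 1#
  ... | no  _ = 0#

  _⊗_ : ∀ {m} → Mat m → Mat m → Mat m
  _⊗_ {m} A B i j = sumR m (λ t → A i t * B t j)

  _⊖_ : ∀ {m} → Mat m → Mat m → Mat m
  (A ⊖ B) i j = A i j - B i j

  ⊝_ : ∀ {m} → Mat m → Mat m
  (⊝ A) i j = - A i j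

  _⊕_ : ∀ {m} → Mat m → Mat m → Mat m
  (A ⊕ B) i j = A i j + B i j

  matPow : ∀ {m} → Mat m → ℕ → Mat m
  matPow A zero    = I
  matPow A (suc n) = A ⊗ matPow A n

  _≋_ : ∀ {m} → Mat m → Mat m → Set ℓ
  A ≋ B = ∀ i j → A i j ≈ B i j

  -- membership in T_p : (p+1)×(p+1) upper unitriangular matrices
  IsUnitriangular : ∀ p → Mat (suc p) → Set ℓ
  IsUnitriangular p A =
    (∀ i → A i i ≈ 1#) × (∀ i j → j < i → A i j ≈ 0#)
    where open import Data.Product using (_×_)

  -- the group inverse in T_p: for U = I + N with N strictly upper
  -- triangular (so N^{p+1} = 0), U⁻¹ = Σ_{i=0}^{p} (-N)^i
  geomSum : ∀ {m} → Mat m → ℕ → Mat m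
  geomSum A zero    = I
  geomSum A (suc n) = matPow A (suc n) ⊕ geomSum A n

  inv : ∀ p → Mat (suc p) → Mat (suc p)
  inv p U = geomSum (⊝ (U ⊖ I)) p

  ∂ : ∀ {p r} → ℤ → (Fin r → ℤ → Mat (suc p)) → (Fin r → ℤ → Mat (suc p))
  ∂ {p} h g l n = g l (n +ℤ h) ⊗ inv p (g l n)

  -- iterated derivative ∂_{h_m} ⋯ ∂_{h_1} g, with h_1 = h zero applied first
  ∂* : ∀ {p r} m → (Fin m → ℤ) → (Fin r → ℤ → Mat (suc p)) → (Fin r → ℤ → Mat (suc p))
  ∂* zero    h g = g
  ∂* (suc m) h g = ∂* m (h ∘ suc) (∂ (h zero) g)

  IsPolyMap : ∀ k p r → (Fin r → ℤ → Mat (suc p)) → Set (c Level.⊔ ℓ)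
  IsPolyMap k p r ρ =
    (∀ l n → IsUnitriangular p (ρ l n)) ×
    Σ' (Fin (suc p) → Fin (suc p) → Fin r → Poly k)
       (λ φ → ∀ i j l n → ρ l n i j ≈ evalPoly (φ i j l) n)
    where open import Data.Product using (_×_) renaming (Σ to Σ')

{-# OPTIONS --safe #-}
-- Weight the s-th superdiagonal by s·k. The entries of ρ there are polynomials of degree
-- at most k ≤ s·k, and this grading survives sums, products and the inverse
-- g⁻¹ = Σᵢ₌₀ᵖ (I − g)ⁱ of a unitriangular g. Since (∂_h g)(n) − I = (g(n+h) − g(n)) g(n)⁻¹,
-- the (i,j) entry of ∂_h g is Σ_{i<t≤j} Δ_h g_{it} · (g⁻¹)_{tj}, whose terms have degree
-- below the bound for g_{it} plus (j − t)·k: every derivative lowers the bound on each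
-- superdiagonal by one. After p·k + 1 derivatives no superdiagonal s ≤ p has room left,
-- so d = p·k works. Degrees are measured, over any commutative ring, by the vanishing of
-- iterated finite differences.
module Submission where

open import Level using (Level)
open import Algebra.Bundles using (CommutativeRing)
open import Data.Nat as ℕ using (ℕ; zero; suc; z≤n; s≤s; _∸_)
import Data.Nat.Properties as ℕP
open import Data.Fin as Fin using (Fin; zero; suc; toℕ)
import Data.Fin.Properties as FinP
open import Data.Integer as ℤ using (ℤ; +_; -[1+_])
import Data.Integer.Properties as ℤP
import Algebra.Properties.CommutativeSemigroup ℤP.+-commutativeSemigroup as ℤ+
import Algebra.Properties.CommutativeSemigroup ℕP.+-commutativeSemigroup as ℕ+
open import Data.Product using (Σ; _×_; _,_; proj₁; proj₂; map₂; uncurry)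
open import Data.Sum using (inj₁; inj₂)
open import Function using (_∘_)
open import Relation.Binary.PropositionalEquality as ≡ using (_≡_; _≢_)
open import Relation.Nullary using (yes; no)
open import Data.Empty using (⊥-elim)
open import Defs

module _ {c ℓ : Level} (R : CommutativeRing c ℓ) where
  open CommutativeRing R hiding (zero)
  open import Algebra.Properties.Ring ring using (x[y-z]≈xy-xz; [y-z]x≈yx-zx)
  open import Algebra.Properties.AbelianGroup +-abelianGroup
    using (⁻¹-∙-comm; xyx⁻¹≈y; ε⁻¹≈ε; ⁻¹-involutive; //-rightDividesˡ; \\-leftDividesʳ; x∙y⁻¹≈ε⇒x≈y)
  open import Algebra.Properties.CommutativeSemigroup +-commutativeSemigroup
    using (interchange)
  open import Relation.Binary.Reasoning.Setoid setoid

  x≈x-y+y : ∀ x y → x ≈ (x - y) + y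
  x≈x-y+y x y = sym (//-rightDividesˡ y x)

  0-0≈0 : 0# - 0# ≈ 0#
  0-0≈0 = -‿inverseʳ 0#

  [a+b]-[c+d]≈[a-c]+[b-d] : ∀ a b c d → (a + b) - (c + d) ≈ (a - c) + (b - d)
  [a+b]-[c+d]≈[a-c]+[b-d] a b c d =
    trans (+-congˡ (sym (⁻¹-∙-comm c d))) (interchange a b (- c) (- d))

  ab-cd≈[a-c]b+c[b-d] : ∀ a b c d → a * b - c * d ≈ (a - c) * b + c * (b - d)
  ab-cd≈[a-c]b+c[b-d] a b c d = begin
    a * b - c * d                         ≈⟨ +-congʳ (x≈x-y+y (a * b) (c * b)) ⟩
    ((a * b - c * b) + c * b) - c * d     ≈⟨ +-assoc _ _ _ ⟩
    (a * b - c * b) + (c * b - c * d)     ≈⟨ +-cong ([y-z]x≈yx-zx b a c) (x[y-z]≈xy-xz c b d) ⟨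
    (a - c) * b + c * (b - d)             ∎

  [a-b]+[c-a]≈c-b : ∀ a b c → (a - b) + (c - a) ≈ c - b
  [a-b]+[c-a]≈c-b a b c = begin
    (a - b) + (c - a)    ≈⟨ +-comm _ _ ⟩
    (c - a) + (a - b)    ≈⟨ +-assoc _ _ _ ⟩
    c + (- a + (a - b))  ≈⟨ +-congˡ (\\-leftDividesʳ a (- b)) ⟩
    c - b                ∎

  x≈0⇒x*y≈0 : ∀ {x} y → x ≈ 0# → x * y ≈ 0#
  x≈0⇒x*y≈0 y x≈0 = trans (*-congʳ x≈0) (zeroˡ y)

  y≈0⇒x*y≈0 : ∀ x {y} → y ≈ 0# → x * y ≈ 0#
  y≈0⇒x*y≈0 x y≈0 = trans (*-congˡ y≈0) (zeroʳ x)

  Δ : ℤ → (ℤ → Carrier) → ℤ → Carrier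
  Δ h f n = f (n ℤ.+ h) - f n

  Deg< : ℕ → (ℤ → Carrier) → Set ℓ
  Deg< zero    f = ∀ n → f n ≈ 0#
  Deg< (suc m) f = ∀ h → Deg< m (Δ h f)

  Deg<-cong : ∀ m {f g} → (∀ n → f n ≈ g n) → Deg< m f → Deg< m g
  Deg<-cong zero    f≈g f0 n = trans (sym (f≈g n)) (f0 n)
  Deg<-cong (suc m) f≈g df h =
    Deg<-cong m (λ n → +-cong (f≈g (n ℤ.+ h)) (-‿cong (f≈g n))) (df h)

  ≈0⇒Deg< : ∀ m {f} → (∀ n → f n ≈ 0#) → Deg< m f
  ≈0⇒Deg< zero    f0 = f0
  ≈0⇒Deg< (suc m) f0 h = ≈0⇒Deg< m (λ n → trans (+-cong (f0 (n ℤ.+ h)) (-‿cong (f0 n))) 0-0≈0)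

  Deg<-mono : ∀ {m m′ f} → m ℕ.≤ m′ → Deg< m f → Deg< m′ f
  Deg<-mono {m′ = m′} z≤n     f0    = ≈0⇒Deg< m′ f0
  Deg<-mono           (s≤s m≤m′) df h = Deg<-mono m≤m′ (df h)

  Deg<-Δ : ∀ m {f} h → Deg< m f → Deg< (ℕ.pred m) (Δ h f)
  Deg<-Δ zero    h f0 = ≈0⇒Deg< 1 f0 h
  Deg<-Δ (suc m) h df = df h

  Deg<-const : ∀ a → Deg< 1 (λ _ → a)
  Deg<-const a h n = -‿inverseʳ a

  Deg<-+ : ∀ m {f g} → Deg< m f → Deg< m g → Deg< m (λ n → f n + g n)
  Deg<-+ zero    f0 g0 n = trans (+-cong (f0 n) (g0 n)) (+-identityʳ 0#)
  Deg<-+ (suc m) {f} {g} df dg h = Deg<-cong m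
    (λ n → sym ([a+b]-[c+d]≈[a-c]+[b-d] (f (n ℤ.+ h)) (g (n ℤ.+ h)) (f n) (g n)))
    (Deg<-+ m (df h) (dg h))

  Deg<-neg : ∀ m {f} → Deg< m f → Deg< m (λ n → - f n)
  Deg<-neg zero    f0 n = trans (-‿cong (f0 n)) ε⁻¹≈ε
  Deg<-neg (suc m) {f} df h =
    Deg<-cong m (λ n → sym (⁻¹-∙-comm (f (n ℤ.+ h)) (- f n))) (Deg<-neg m (df h))

  Deg<-shift : ∀ m {f} k → Deg< m f → Deg< m (λ n → f (n ℤ.+ k))
  Deg<-shift zero    k f0 n = f0 (n ℤ.+ k)
  Deg<-shift (suc m) {f} k df h = Deg<-cong m shift-Δ (Deg<-shift m k (df h))
    where
    shift-Δ : ∀ n → Δ h f (n ℤ.+ k) ≈ Δ h (λ n → f (n ℤ.+ k)) n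
    shift-Δ n = +-congʳ (reflexive (≡.cong f (ℤ+.xy∙z≈xz∙y n k h)))

  Deg<-* : ∀ m m′ {f g} → Deg< m f → Deg< (suc m′) g → Deg< (m ℕ.+ m′) (λ n → f n * g n)
  Deg<-* zero    m′ {g = g} f0 _ = ≈0⇒Deg< m′ (λ n → x≈0⇒x*y≈0 (g n) (f0 n))
  Deg<-* (suc m) m′ {f} {g} df dg h = Deg<-cong (m ℕ.+ m′)
    (λ n → sym (ab-cd≈[a-c]b+c[b-d] (f (n ℤ.+ h)) (g (n ℤ.+ h)) (f n) (g n)))
    (Deg<-+ (m ℕ.+ m′) (Deg<-* m m′ (df h) (Deg<-shift (suc m′) h dg)) (f·Δg m′ (dg h)))
    where
    f·Δg : ∀ m′ → Deg< m′ (Δ h g) → Deg< (m ℕ.+ m′) (λ n → f n * Δ h g n)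
    f·Δg zero     Δg0 = ≈0⇒Deg< (m ℕ.+ zero) (λ n → y≈0⇒x*y≈0 (f n) (Δg0 n))
    f·Δg (suc m′) dΔg = ≡.subst (λ e → Deg< e (λ n → f n * Δ h g n)) (≡.sym (ℕP.+-suc m m′)) (Deg<-* (suc m) m′ df dΔg)

  Deg<-*-∸ : ∀ x y m {f g} → Deg< (x ∸ m) f → Deg< (suc y) g → Deg< ((x ℕ.+ y) ∸ m) (λ n → f n * g n)
  Deg<-*-∸ x y m {f} {g} df dg with m ℕ.≤? x
  ... | yes m≤x = ≡.subst (λ e → Deg< e (λ n → f n * g n)) (≡.sym (ℕP.+-∸-comm y m≤x))
                    (Deg<-* (x ∸ m) y df dg)
  ... | no  m≰x = ≈0⇒Deg< ((x ℕ.+ y) ∸ m) (λ n → x≈0⇒x*y≈0 (g n) (f≈0 n))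
    where
    f≈0 : ∀ n → f n ≈ 0#
    f≈0 = ≡.subst (λ e → Deg< e f) (ℕP.m≤n⇒m∸n≡0 (ℕP.<⇒≤ (ℕP.≰⇒> m≰x))) df

  Deg<-sum : ∀ m N {F : Fin N → ℤ → Carrier} → (∀ t → Deg< m (F t)) →
             Deg< m (λ n → sumR R N (λ t → F t n))
  Deg<-sum m zero    dF = ≈0⇒Deg< m (λ _ → refl)
  Deg<-sum m (suc N) dF = Deg<-+ m (dF zero) (Deg<-sum m N (dF ∘ suc))

  natR-+ : ∀ m n → natR R (m ℕ.+ n) ≈ natR R m + natR R n
  natR-+ zero    n = sym (+-identityˡ _)
  natR-+ (suc m) n = trans (+-congˡ (natR-+ m n)) (sym (+-assoc _ _ _))

  intR-⊖ : ∀ m n → intR R (m ℤ.⊖ n) ≈ natR R m - natR R n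
  intR-⊖ m       zero    = sym (trans (+-congˡ ε⁻¹≈ε) (+-identityʳ _))
  intR-⊖ zero    (suc n) = sym (+-identityˡ _)
  intR-⊖ (suc m) (suc n) = begin
    intR R (suc m ℤ.⊖ suc n)            ≡⟨ ≡.cong (intR R) (ℤP.[1+m]⊖[1+n]≡m⊖n m n) ⟩
    intR R (m ℤ.⊖ n)                    ≈⟨ intR-⊖ m n ⟩
    natR R m - natR R n                 ≈⟨ +-identityˡ _ ⟨
    0# + (natR R m - natR R n)          ≈⟨ +-congʳ (-‿inverseʳ 1#) ⟨
    (1# - 1#) + (natR R m - natR R n)   ≈⟨ [a+b]-[c+d]≈[a-c]+[b-d] 1# (natR R m) 1# (natR R n) ⟨
    natR R (suc m) - natR R (suc n)     ∎

  intR-+ : ∀ x y → intR R (x ℤ.+ y) ≈ intR R x + intR R y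
  intR-+ (+ m)    (+ n)    = natR-+ m n
  intR-+ (+ m)    -[1+ n ] = intR-⊖ m (suc n)
  intR-+ -[1+ m ] (+ n)    = trans (intR-⊖ n (suc m)) (+-comm _ _)
  intR-+ -[1+ m ] -[1+ n ] = begin
    - natR R (suc (suc (m ℕ.+ n)))      ≡⟨ ≡.cong (λ e → - natR R (suc e)) (ℕP.+-suc m n) ⟨
    - natR R (suc m ℕ.+ suc n)          ≈⟨ -‿cong (natR-+ (suc m) (suc n)) ⟩
    - (natR R (suc m) + natR R (suc n)) ≈⟨ ⁻¹-∙-comm _ _ ⟨
    - natR R (suc m) - natR R (suc n)   ∎

  Deg<-intR : Deg< 2 (intR R)
  Deg<-intR h = Deg<-cong 1 (λ n → sym (Δ-intR n)) (Deg<-const (intR R h))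
    where
    Δ-intR : ∀ n → Δ h (intR R) n ≈ intR R h
    Δ-intR n = trans (+-congʳ (intR-+ n h)) (xyx⁻¹≈y (intR R n) (intR R h))

  Deg<-pow : ∀ j → Deg< (suc j) (λ n → pow R (intR R n) j)
  Deg<-pow zero    = Deg<-const 1#
  Deg<-pow (suc j) = Deg<-* 2 j Deg<-intR (Deg<-pow j)

  Deg<-evalPoly : ∀ k (a : Poly R k) → Deg< (suc k) (evalPoly R a)
  Deg<-evalPoly k a = Deg<-sum (suc k) (suc k) monomial
    where
    monomial : ∀ t → Deg< (suc k) (λ n → a t * pow R (intR R n) (toℕ t))
    monomial t = Deg<-mono (FinP.toℕ<n t) (Deg<-* 1 (toℕ t) (Deg<-const (a t)) (Deg<-pow (toℕ t)))

  sumR-cong : ∀ N {f g : Fin N → Carrier} → (∀ t → f t ≈ g t) → sumR R N f ≈ sumR R N g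
  sumR-cong zero    f≈g = refl
  sumR-cong (suc N) f≈g = +-cong (f≈g zero) (sumR-cong N (f≈g ∘ suc))

  sumR-zero : ∀ N {f : Fin N → Carrier} → (∀ t → f t ≈ 0#) → sumR R N f ≈ 0#
  sumR-zero zero    f0 = refl
  sumR-zero (suc N) f0 = trans (+-cong (f0 zero) (sumR-zero N (f0 ∘ suc))) (+-identityʳ 0#)

  sumR-+ : ∀ N (f g : Fin N → Carrier) → sumR R N (λ t → f t + g t) ≈ sumR R N f + sumR R N g
  sumR-+ zero    f g = sym (+-identityʳ 0#)
  sumR-+ (suc N) f g = trans (+-congˡ (sumR-+ N (f ∘ suc) (g ∘ suc))) (interchange _ _ _ _)

  sumR-neg : ∀ N (f : Fin N → Carrier) → sumR R N (λ t → - f t) ≈ - sumR R N f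
  sumR-neg zero    f = sym ε⁻¹≈ε
  sumR-neg (suc N) f = trans (+-congˡ (sumR-neg N (f ∘ suc))) (⁻¹-∙-comm _ _)

  sumR-single : ∀ N (f : Fin N → Carrier) i → (∀ t → t ≢ i → f t ≈ 0#) → sumR R N f ≈ f i
  sumR-single (suc N) f zero    f0 =
    trans (+-congˡ (sumR-zero N (λ t → f0 (suc t) λ ()))) (+-identityʳ _)
  sumR-single (suc N) f (suc i) f0 =
    trans (+-congʳ (f0 zero λ ())) (trans (+-identityˡ _)
      (sumR-single N (f ∘ suc) i (λ t t≢i → f0 (suc t) (t≢i ∘ FinP.suc-injective))))

  module _ {m : ℕ} where
    I-diag : ∀ i → I R {m} i i ≈ 1#
    I-diag i with i Fin.≟ i
    ... | yes _   = refl
    ... | no  i≢i = ⊥-elim (i≢i ≡.refl)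

    I-off : ∀ i j → i ≢ j → I R {m} i j ≈ 0#
    I-off i j i≢j with i Fin.≟ j
    ... | yes i≡j = ⊥-elim (i≢j i≡j)
    ... | no  _   = refl

    ⊗-congˡ : ∀ {A A′ B : Mat R m} → _≋_ R A A′ → _≋_ R (_⊗_ R A B) (_⊗_ R A′ B)
    ⊗-congˡ A≋A′ i j = sumR-cong m (λ t → *-congʳ (A≋A′ i t))

    I-⊗ : ∀ (A : Mat R m) → _≋_ R (_⊗_ R (I R) A) A
    I-⊗ A i j = trans (sumR-single m _ i off) (trans (*-congʳ (I-diag i)) (*-identityˡ _))
      where
      off : ∀ t → t ≢ i → I R i t * A t j ≈ 0#
      off t t≢i = x≈0⇒x*y≈0 (A t j) (I-off i t (t≢i ∘ ≡.sym))

    ⊗-I : ∀ (A : Mat R m) → _≋_ R (_⊗_ R A (I R)) A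
    ⊗-I A i j = trans (sumR-single m _ j off) (trans (*-congˡ (I-diag j)) (*-identityʳ _))
      where
      off : ∀ t → t ≢ j → A i t * I R t j ≈ 0#
      off t t≢j = y≈0⇒x*y≈0 (A i t) (I-off t j t≢j)

    ⊗-distribˡ-⊕ : ∀ (A B C : Mat R m) → _≋_ R (_⊗_ R A (_⊕_ R B C)) (_⊕_ R (_⊗_ R A B) (_⊗_ R A C))
    ⊗-distribˡ-⊕ A B C i j = trans (sumR-cong m (λ t → distribˡ _ _ _)) (sumR-+ m _ _)

    ⊗-distribʳ-⊖ : ∀ (A B C : Mat R m) → _≋_ R (_⊗_ R (_⊖_ R A B) C) (_⊖_ R (_⊗_ R A C) (_⊗_ R B C))
    ⊗-distribʳ-⊖ A B C i j = begin
      sumR R m (λ t → (A i t - B i t) * C t j)          ≈⟨ sumR-cong m (λ t → [y-z]x≈yx-zx _ _ _) ⟩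
      sumR R m (λ t → A i t * C t j - B i t * C t j)    ≈⟨ sumR-+ m _ _ ⟩
      _ + sumR R m (λ t → - (B i t * C t j))            ≈⟨ +-congˡ (sumR-neg m _) ⟩
      _ ∎

    geomSum-telescope : ∀ (X : Mat R m) n →
      _≋_ R (_⊗_ R (_⊖_ R (I R) X) (geomSum R X n)) (_⊖_ R (I R) (matPow R X (suc n)))
    geomSum-telescope X zero    i j = trans (⊗-I (_⊖_ R (I R) X) i j) (+-congˡ (-‿cong (sym (⊗-I X i j))))
    geomSum-telescope X (suc n) i j = begin
      _ ≈⟨ ⊗-distribˡ-⊕ (_⊖_ R (I R) X) (matPow R X (suc n)) (geomSum R X n) i j ⟩
      _ ≈⟨ +-cong (⊗-distribʳ-⊖ (I R) X (matPow R X (suc n)) i j) (geomSum-telescope X n i j) ⟩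
      _ ≈⟨ +-congʳ (+-congʳ (I-⊗ (matPow R X (suc n)) i j)) ⟩
      (Xⁿ⁺¹ - Xⁿ⁺²) + (I R i j - Xⁿ⁺¹) ≈⟨ [a-b]+[c-a]≈c-b Xⁿ⁺¹ Xⁿ⁺² (I R i j) ⟩
      I R i j - Xⁿ⁺² ∎
      where
      Xⁿ⁺¹ = matPow R X (suc n) i j
      Xⁿ⁺² = matPow R X (suc (suc n)) i j

    Upper : ℕ → Mat R m → Set ℓ
    Upper k A = ∀ i j → toℕ j ℕ.< k ℕ.+ toℕ i → A i j ≈ 0#

    Upper-I : Upper 0 (I R)
    Upper-I i j j<i = I-off i j (λ i≡j → ℕP.<-irrefl (≡.cong toℕ (≡.sym i≡j)) j<i)

    Upper-⊕ : ∀ {k A B} → Upper k A → Upper k B → Upper k (_⊕_ R A B)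
    Upper-⊕ uA uB i j j<k+i = trans (+-cong (uA i j j<k+i) (uB i j j<k+i)) (+-identityʳ 0#)

    Upper-⊝ : ∀ {k A} → Upper k A → Upper k (⊝_ R A)
    Upper-⊝ uA i j j<k+i = trans (-‿cong (uA i j j<k+i)) ε⁻¹≈ε

    Upper-⊗ : ∀ {a b A B} → Upper a A → Upper b B → Upper (a ℕ.+ b) (_⊗_ R A B)
    Upper-⊗ {a} {b} {A} {B} uA uB i j j<a+b+i = sumR-zero m term
      where
      term : ∀ t → A i t * B t j ≈ 0#
      term t with toℕ t ℕ.<? a ℕ.+ toℕ i
      ... | yes t<a+i = x≈0⇒x*y≈0 (B t j) (uA i t t<a+i)
      ... | no  t≮a+i = y≈0⇒x*y≈0 (A i t) (uB t j (ℕP.<-≤-trans j<a+b+i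
              (ℕP.≤-trans (ℕP.≤-reflexive (ℕ+.xy∙z≈y∙xz a b (toℕ i))) (ℕP.+-monoʳ-≤ b (ℕP.≮⇒≥ t≮a+i)))))

    Upper-matPow : ∀ {k X} → Upper k X → ∀ q → Upper (q ℕ.* k) (matPow R X q)
    Upper-matPow uX zero    = Upper-I
    Upper-matPow uX (suc q) = Upper-⊗ uX (Upper-matPow uX q)

    Upper-vanishes : ∀ {k A} → m ℕ.≤ k → Upper k A → ∀ i j → A i j ≈ 0#
    Upper-vanishes {k} m≤k uA i j = uA i j (ℕP.<-≤-trans (FinP.toℕ<n j) (ℕP.≤-trans m≤k (ℕP.m≤m+n k (toℕ i))))

  unitriangular-⊖ : ∀ {p A B} → IsUnitriangular R p A → IsUnitriangular R p B → Upper 1 (_⊖_ R A B)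
  unitriangular-⊖ (A-diag , A-low) (B-diag , B-low) i j (s≤s j≤i) with ℕP.m≤n⇒m<n∨m≡n j≤i
  ... | inj₁ j<i = trans (+-cong (A-low i j j<i) (-‿cong (B-low i j j<i))) 0-0≈0
  ... | inj₂ j≡i with FinP.toℕ-injective j≡i
  ... | ≡.refl = trans (+-cong (A-diag i) (-‿cong (B-diag i))) (-‿inverseʳ 1#)

  I-unitriangular : ∀ p → IsUnitriangular R p (I R)
  I-unitriangular p = I-diag , λ i j j<i → Upper-I i j j<i

  inv-right : ∀ p {g} → IsUnitriangular R p g → _≋_ R (_⊗_ R g (inv R p g)) (I R)
  inv-right p {g} g-unitri i j = begin
    _⊗_ R g (geomSum R X p) i j                         ≈⟨ ⊗-congˡ {B = geomSum R X p} g≋I-X i j ⟩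
    _⊗_ R (_⊖_ R (I R) X) (geomSum R X p) i j           ≈⟨ geomSum-telescope X p i j ⟩
    I R i j - matPow R X (suc p) i j                    ≈⟨ +-congˡ (-‿cong Xᵖ⁺¹≈0) ⟩
    I R i j - 0#                                        ≈⟨ +-congˡ ε⁻¹≈ε ⟩
    I R i j + 0#                                        ≈⟨ +-identityʳ _ ⟩
    I R i j                                             ∎
    where
    X = ⊝_ R (_⊖_ R g (I R))
    g≋I-X : _≋_ R g (_⊖_ R (I R) X)
    g≋I-X a b = trans (x≈x-y+y (g a b) (I R a b)) (trans (+-comm _ _) (+-congˡ (sym (⁻¹-involutive _))))
    Xᵖ⁺¹≈0 : matPow R X (suc p) i j ≈ 0#
    Xᵖ⁺¹≈0 = Upper-vanishes (ℕP.≤-reflexive (≡.sym (ℕP.*-identityʳ (suc p))))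
               (Upper-matPow (Upper-⊝ (unitriangular-⊖ g-unitri (I-unitriangular p))) (suc p)) i j

  Deg<-⊗ : ∀ {m a b e} {A B : ℤ → Mat R m} i j →
           (∀ n → Upper a (A n)) → (∀ n → Upper b (B n)) →
           (∀ t u v → (a ℕ.+ u) ℕ.+ toℕ i ≡ toℕ t → (b ℕ.+ v) ℕ.+ toℕ t ≡ toℕ j →
                      Deg< e (λ n → A n i t * B n t j)) →
           Deg< e (λ n → _⊗_ R (A n) (B n) i j)
  Deg<-⊗ {m} {a} {b} {e} {A} {B} i j uA uB dAB = Deg<-sum e m term
    where
    term : ∀ t → Deg< e (λ n → A n i t * B n t j)
    term t with toℕ t ℕ.<? a ℕ.+ toℕ i | toℕ j ℕ.<? b ℕ.+ toℕ t
    ... | yes t<a+i | _         = ≈0⇒Deg< e (λ n → x≈0⇒x*y≈0 (B n t j) (uA n i t t<a+i))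
    ... | no  _     | yes j<b+t = ≈0⇒Deg< e (λ n → y≈0⇒x*y≈0 (A n i t) (uB n t j j<b+t))
    ... | no  t≮a+i | no  j≮b+t
      with u , a+i+u≡t ← ℕP.m≤n⇒∃[o]m+o≡n (ℕP.≮⇒≥ t≮a+i)
         | v , b+t+v≡j ← ℕP.m≤n⇒∃[o]m+o≡n (ℕP.≮⇒≥ j≮b+t)
      = dAB t u v (≡.trans (ℕ+.xy∙z≈xz∙y a u (toℕ i)) a+i+u≡t)
                  (≡.trans (ℕ+.xy∙z≈xz∙y b v (toℕ t)) b+t+v≡j)

  offset-+ : ∀ u v s {i t j} → u ℕ.+ i ≡ t → v ℕ.+ t ≡ j → s ℕ.+ i ≡ j → s ≡ u ℕ.+ v
  offset-+ u v s {i} ≡.refl ≡.refl s+i≡j =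
    ℕP.+-cancelʳ-≡ i s (u ℕ.+ v) (≡.trans s+i≡j (≡.sym (ℕ+.xy∙z≈y∙xz u v i)))

  offset-suc⇒≢ : ∀ {n s} {i j : Fin n} → suc s ℕ.+ toℕ i ≡ toℕ j → i ≢ j
  offset-suc⇒≢ {i = i} s+i≡j ≡.refl = ℕP.m≢1+n+m (toℕ i) (≡.sym s+i≡j)

  module _ (p k : ℕ) where
    Graded : (ℤ → Mat R (suc p)) → Set ℓ
    Graded A = (∀ n → Upper 0 (A n)) ×
               (∀ i j s → s ℕ.+ toℕ i ≡ toℕ j → Deg< (suc (s ℕ.* k)) (λ n → A n i j))

    Graded-I : Graded (λ _ → I R)
    Graded-I = (λ _ → Upper-I) , λ i j s _ → Deg<-mono (s≤s z≤n) (Deg<-const (I R i j))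

    Graded-⊕ : ∀ {A B} → Graded A → Graded B → Graded (λ n → _⊕_ R (A n) (B n))
    Graded-⊕ {A} {B} (uA , dA) (uB , dB) = (λ n → Upper-⊕ (uA n) (uB n)) , λ i j s s+i≡j →
      Deg<-+ (suc (s ℕ.* k)) {λ n → A n i j} {λ n → B n i j} (dA i j s s+i≡j) (dB i j s s+i≡j)

    Graded-⊝ : ∀ {A} → Graded A → Graded (λ n → ⊝_ R (A n))
    Graded-⊝ {A} (uA , dA) = (λ n → Upper-⊝ (uA n)) , λ i j s s+i≡j →
      Deg<-neg (suc (s ℕ.* k)) {λ n → A n i j} (dA i j s s+i≡j)

    Graded-⊗ : ∀ {A B} → Graded A → Graded B → Graded (λ n → _⊗_ R (A n) (B n))
    Graded-⊗ {A} {B} (uA , dA) (uB , dB) = (λ n → Upper-⊗ (uA n) (uB n)) , deg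
      where
      deg : ∀ i j s → s ℕ.+ toℕ i ≡ toℕ j → Deg< (suc (s ℕ.* k)) (λ n → _⊗_ R (A n) (B n) i j)
      deg i j s s+i≡j = Deg<-⊗ {e = suc (s ℕ.* k)} {A = A} {B = B} i j uA uB λ t u v u+i≡t v+t≡j →
        ≡.subst (λ e → Deg< (suc e) (λ n → A n i t * B n t j))
          (≡.trans (≡.sym (ℕP.*-distribʳ-+ k u v)) (≡.cong (ℕ._* k) (≡.sym (offset-+ u v s u+i≡t v+t≡j s+i≡j))))
          (Deg<-* (suc (u ℕ.* k)) (v ℕ.* k) (dA i t u u+i≡t) (dB t j v v+t≡j))

    Graded-matPow : ∀ {X} → Graded X → ∀ q → Graded (λ n → matPow R (X n) q)
    Graded-matPow gX zero    = Graded-I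
    Graded-matPow gX (suc q) = Graded-⊗ gX (Graded-matPow gX q)

    Graded-geomSum : ∀ {X} → Graded X → ∀ q → Graded (λ n → geomSum R (X n) q)
    Graded-geomSum gX zero    = Graded-I
    Graded-geomSum gX (suc q) = Graded-⊕ (Graded-matPow gX (suc q)) (Graded-geomSum gX q)

    Graded-inv : ∀ {g} → Graded g → Graded (λ n → inv R p (g n))
    Graded-inv gg = Graded-geomSum (Graded-⊝ (Graded-⊕ gg (Graded-⊝ Graded-I))) p

    Unitriangular : (ℤ → Mat R (suc p)) → Set ℓ
    Unitriangular g = ∀ n → IsUnitriangular R p (g n)

    -- The invariant after m derivatives: degree < 1 + s·k − m on the s-th superdiagonal, s ≥ 1.
    Filtered : ℕ → (ℤ → Mat R (suc p)) → Set ℓ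
    Filtered m g = ∀ i j s → suc s ℕ.+ toℕ i ≡ toℕ j → Deg< (suc (suc s ℕ.* k) ∸ m) (λ n → g n i j)

    unitriangular-graded : ∀ {m g} → Unitriangular g → Filtered m g → Graded g
    unitriangular-graded {m} {g} g-unitri fg = (λ n → proj₂ (g-unitri n)) , deg
      where
      deg : ∀ i j s → s ℕ.+ toℕ i ≡ toℕ j → Deg< (suc (s ℕ.* k)) (λ n → g n i j)
      deg i j zero    i≡j with FinP.toℕ-injective i≡j
      ... | ≡.refl = Deg<-cong 1 (λ n → sym (proj₁ (g-unitri n) i)) (Deg<-const 1#)
      deg i j (suc s) s+i≡j = Deg<-mono (ℕP.m∸n≤m _ m) (fg i j s s+i≡j)

    ∂-filtered : ∀ {m g} h → Unitriangular g → Filtered m g →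
                 Unitriangular (λ n → _⊗_ R (g (n ℤ.+ h)) (inv R p (g n))) ×
                 Filtered (suc m) (λ n → _⊗_ R (g (n ℤ.+ h)) (inv R p (g n)))
    ∂-filtered {m} {g} h g-unitri fg = ∂g-unitri , ∂g-filtered
      where
      G D P : ℤ → Mat R (suc p)
      G n = inv R p (g n)
      D n = _⊖_ R (g (n ℤ.+ h)) (g n)
      P n = _⊗_ R (D n) (G n)

      G-graded : Graded G
      G-graded = Graded-inv (unitriangular-graded {m} g-unitri fg)

      D-upper : ∀ n → Upper 1 (D n)
      D-upper n = unitriangular-⊖ (g-unitri (n ℤ.+ h)) (g-unitri n)

      P-upper : ∀ n → Upper 1 (P n)
      P-upper n = Upper-⊗ (D-upper n) (proj₁ G-graded n)

      ∂g≈P+I : ∀ n i j → _⊗_ R (g (n ℤ.+ h)) (G n) i j ≈ P n i j + I R i j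
      ∂g≈P+I n i j = begin
        _⊗_ R (g (n ℤ.+ h)) (G n) i j
          ≈⟨ x≈x-y+y _ (_⊗_ R (g n) (G n) i j) ⟩
        (_⊗_ R (g (n ℤ.+ h)) (G n) i j - _⊗_ R (g n) (G n) i j) + _⊗_ R (g n) (G n) i j
          ≈⟨ +-cong (sym (⊗-distribʳ-⊖ (g (n ℤ.+ h)) (g n) (G n) i j)) (inv-right p (g-unitri n) i j) ⟩
        P n i j + I R i j
          ∎

      ∂g-unitri : Unitriangular (λ n → _⊗_ R (g (n ℤ.+ h)) (G n))
      ∂g-unitri n = diag , low
        where
        diag : ∀ i → _⊗_ R (g (n ℤ.+ h)) (G n) i i ≈ 1#
        diag i = trans (∂g≈P+I n i i) (trans (+-cong (P-upper n i i (ℕP.n<1+n _)) (I-diag i)) (+-identityˡ 1#))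
        low : ∀ i j → j Fin.< i → _⊗_ R (g (n ℤ.+ h)) (G n) i j ≈ 0#
        low i j j<i = trans (∂g≈P+I n i j)
          (trans (+-cong (P-upper n i j (ℕP.m<n⇒m<1+n j<i)) (Upper-I i j j<i)) (+-identityʳ 0#))

      ∂g-filtered : Filtered (suc m) (λ n → _⊗_ R (g (n ℤ.+ h)) (G n))
      ∂g-filtered i j s s+i≡j = Deg<-cong (suc s ℕ.* k ∸ m) P≈∂g
        (Deg<-⊗ {e = suc s ℕ.* k ∸ m} {A = D} {B = G} i j D-upper (proj₁ G-graded) term)
        where
        P≈∂g : ∀ n → P n i j ≈ _⊗_ R (g (n ℤ.+ h)) (G n) i j
        P≈∂g n = sym (trans (∂g≈P+I n i j) (trans (+-congˡ (I-off i j (offset-suc⇒≢ s+i≡j))) (+-identityʳ _)))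
        term : ∀ t u v → suc u ℕ.+ toℕ i ≡ toℕ t → v ℕ.+ toℕ t ≡ toℕ j →
               Deg< (suc s ℕ.* k ∸ m) (λ n → D n i t * G n t j)
        term t u v u+i≡t v+t≡j = ≡.subst (λ e → Deg< (e ∸ m) (λ n → D n i t * G n t j)) weights
            (Deg<-*-∸ (suc u ℕ.* k) (v ℕ.* k) m Δg-deg (proj₂ G-graded t j v v+t≡j))
          where
          Δg-deg : Deg< (suc u ℕ.* k ∸ m) (Δ h (λ n → g n i t))
          Δg-deg = ≡.subst (λ e → Deg< e (Δ h (λ n → g n i t)))
            (ℕP.pred[m∸n]≡m∸[1+n] (suc (suc u ℕ.* k)) m) (Deg<-Δ _ h (fg i t u u+i≡t))
          weights : suc u ℕ.* k ℕ.+ v ℕ.* k ≡ suc s ℕ.* k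
          weights = ≡.trans (≡.sym (ℕP.*-distribʳ-+ k (suc u) v))
                            (≡.cong (ℕ._* k) (≡.sym (offset-+ (suc u) v (suc s) u+i≡t v+t≡j s+i≡j)))

    ∂*-filtered : ∀ d {r m} (h : Fin d → ℤ) (ρ : Fin r → ℤ → Mat R (suc p)) →
                  (∀ l → Unitriangular (ρ l) × Filtered m (ρ l)) →
                  ∀ l → Unitriangular (∂* R d h ρ l) × Filtered (d ℕ.+ m) (∂* R d h ρ l)
    ∂*-filtered zero    h ρ fρ = fρ
    ∂*-filtered (suc d) {m = m} h ρ fρ l =
      map₂ (≡.subst (λ e → Filtered e (∂* R (suc d) h ρ l)) (ℕP.+-suc d m))
        (∂*-filtered d (h ∘ suc) (∂ R (h zero) ρ) (λ l′ → uncurry (∂-filtered {m} (h zero)) (fρ l′)) l)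

    filtered-vanishes : ∀ {m g} → suc (p ℕ.* k) ℕ.≤ m → Unitriangular g → Filtered m g →
                        ∀ n → _≋_ R (g n) (I R)
    filtered-vanishes {m} {g} pk<m g-unitri fg n i j with toℕ i ℕ.<? toℕ j
    ... | no  i≮j = x∙y⁻¹≈ε⇒x≈y _ _
          (unitriangular-⊖ (g-unitri n) (I-unitriangular p) i j (s≤s (ℕP.≮⇒≥ i≮j)))
    ... | yes i<j with s , i+s≡j ← ℕP.m≤n⇒∃[o]m+o≡n i<j =
          trans (≡.subst (λ e → Deg< e (λ n → g n i j)) (ℕP.m≤n⇒m∸n≡0 weight<m) (fg i j s offset) n)
                (sym (I-off i j (offset-suc⇒≢ offset)))
      where
      offset : suc s ℕ.+ toℕ i ≡ toℕ j
      offset = ≡.trans (≡.cong suc (ℕP.+-comm s (toℕ i))) i+s≡j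
      s<p : suc s ℕ.≤ p
      s<p = ℕP.≤-trans (ℕP.m≤m+n (suc s) (toℕ i)) (ℕP.≤-trans (ℕP.≤-reflexive offset) (ℕP.≤-pred (FinP.toℕ<n j)))
      weight<m : suc (suc s ℕ.* k) ℕ.≤ m
      weight<m = ℕP.≤-trans (s≤s (ℕP.*-monoˡ-≤ k s<p)) pk<m

    polynomial-filtered : ∀ {r ρ} → IsPolyMap R k p r ρ → ∀ l → Unitriangular (ρ l) × Filtered 0 (ρ l)
    polynomial-filtered (ρ-unitri , φ , ρ≈φ) l = ρ-unitri l , λ i j s _ →
      Deg<-mono (s≤s (ℕP.m≤m+n k (s ℕ.* k)))
        (Deg<-cong (suc k) (λ n → sym (ρ≈φ i j l n)) (Deg<-evalPoly k (φ i j l)))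

lemma6p7 : ∀ {c ℓ} (k p : ℕ) → Σ ℕ λ d →
    ∀ (r : ℕ) (R : CommutativeRing c ℓ) (ρ : Fin r → ℤ → Mat R (suc p)) →
    IsPolyMap R k p r ρ →
    ∀ (h : Fin (suc d) → ℤ) (l : Fin r) (n : ℤ) →
    _≋_ R (∂* R (suc d) h ρ l n) (I R)
lemma6p7 k p = p ℕ.* k , λ r R ρ ρ-poly h l →
  uncurry (filtered-vanishes R p k (ℕP.m≤m+n _ 0))
    (∂*-filtered R p k (suc (p ℕ.* k)) h ρ (polynomial-filtered R p k ρ-poly) l)
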